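{- Let $n\ge 2$, $k\in[n]$, $\mathbf c\in\mathbb R^n$ with $c_1<\dots<c_n$. For a monotone path $P$ on $\Delta(n,k)$, the sequence $\mathscr L(P)$ is a diagonal-avoiding lattice path of size $n$ and dimension $k$ whose list of enhanced steps equals that of $P$, and the map $P\mapsto\mathscr L(P)$ is a bijection from the set of monotone paths on $\Delta(n,k)$ to the set of diagonal-avoiding lattice paths of size $n$ and dimension $k$.
   Context: $\Delta(n,k)=\{\mathbf x\in[0,1]^n:\sum_ix_i=k\}$, vertices are $0/1$-vectors with $k$ ones, $\operatorname{supp}(\mathbf v)=\{i:v_i=1\}$, vertices adjacent iff supports share $k-1$ elements. A monotone path is $(\mathbf v_1,\dots,\mathbf v_r)$ with $\mathbf v_1=(1,\dots,1,0,\dots,0)$, $\mathbf v_r=(0,\dots,0,1,\dots,1)$, consecutive vertices adjacent and $\langle\mathbf v_i,\mathbf c\rangle<\langle\mathbf v_{i+1},\mathbf c\rangle$. Its $i$-th enhanced step is $(x\to y;Z)$ with $Z=\operatorname{supp}\mathbf v_i\cap\operatorname{supp}\mathbf v_{i+1}$, $\{x\}=\operatorname{supp}\mathbf v_i\setminus\operatorname{supp}\mathbf v_{i+1}$, $\{y\}=\operatorname{supp}\mathbf v_{i+1}\setminus\operatorname{supp}\mathbf v_i$. A diagonal-avoiding lattice path of size $n$ and dimension $k$ is a sequence $(\boldsymbol\ell_1,\dots,\boldsymbol\ell_r)$ of points of $[n]^k$ with: $\boldsymbol\ell_1=(k,k-1,\dots,1)$; $\{\ell_{r,1},\dots,\ell_{r,k}\}=\{n-k+1,\dots,n\}$;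 for each $i$ the coordinates $\ell_{i,1},\dots,\ell_{i,k}$ are pairwise distinct; for each $i\in[r-1]$ there is $p\in[k]$ with $\ell_{i,p}<\ell_{i+1,p}$ and $\ell_{i,q}=\ell_{i+1,q}$ for all $q\ne p$. Its $i$-th enhanced step is $(\ell_{i,p}\to\ell_{i+1,p};Z)$ with $Z=\{\ell_{i,q}:q\neq p\}$. For a monotone path $P=(\mathbf v_1,\dots,\mathbf v_r)$, $\mathscr L(P)=(\boldsymbol\ell_1,\dots,\boldsymbol\ell_r)$ is defined by $\boldsymbol\ell_1=(k,\dots,1)$ and, if the $i$-th enhanced step of $P$ is $(x\to y;Z)$, $\boldsymbol\ell_{i+1}$ is obtained from $\boldsymbol\ell_i$ by replacing the (unique) coordinate equal to $x$ by $y$.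
   Formalization: The vector $\mathbf c$ is taken in ℚ^n, with rational entries, instead of $\mathbb R^n$. -}

module Defs where

open import Data.Nat as ℕ using (ℕ; zero; suc; _∸_; _≤ᵇ_; _<ᵇ_)
open import Data.Nat.Properties using (<⇒≤)
open import Data.Bool using (Bool; true; false; if_then_else_; _∧_; _∨_; not)
open import Data.Fin as Fin using (Fin; zero; suc; toℕ; fromℕ<)
open import Data.Fin.Subset using (Subset; _∩_; _─_; ∣_∣)
open import Data.Vec as Vec using (Vec; []; _∷_; lookup; tabulate)
open import Data.Vec.Membership.Propositional using (_∈_)
open import Data.List as List using (List; []; _∷_; downFrom)
open import Data.List.Relation.Unary.All using (All)
open import Data.List.Relation.Unary.Linked using (Linked)
open import Data.Maybe using (Maybe; just; nothing)
open import Data.Product using (Σ; _×_; _,_)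
open import Data.Rational as ℚ using (ℚ; 0ℚ)
open import Relation.Nullary using (¬_)
open import Relation.Nullary.Decidable using (⌊_⌋)
open import Relation.Binary.PropositionalEquality using (_≡_; _≢_)

-- Convention: the ground set [n] = {1,…,n} is represented by Fin n
-- (0-based: paper index i ↔ Fin element i-1).

lastOf : ∀ {a} {A : Set a} → A → List A → A
lastOf x []       = x
lastOf x (y ∷ ys) = lastOf y ys

anyFin : ∀ {m} → (Fin m → Bool) → Bool
anyFin {zero}  f = false
anyFin {suc m} f = f zero ∨ anyFin (λ i → f (suc i))

findFirst : ∀ {m} → (Fin m → Bool) → Maybe (Fin m)
findFirst {zero}  f = nothing
findFirst {suc m} f with f zero
... | true  = just zero
... | false with findFirst (λ i → f (suc i))
...   | just i  = just (suc i)
...   | nothing = nothing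

-- The hypersimplex Δ(n,k): vertices are 0/1 vectors (subsets) with k ones

IsVertex : ∀ {n} → ℕ → Subset n → Set
IsVertex k v = ∣ v ∣ ≡ k

topVertex : (n k : ℕ) → Subset n
topVertex n k = tabulate (λ i → toℕ i <ᵇ k)

bottomVertex : (n k : ℕ) → Subset n
bottomVertex n k = tabulate (λ i → (n ∸ k) ≤ᵇ toℕ i)

Adjacent : ∀ {n} → ℕ → Subset n → Subset n → Set
Adjacent k v w = ∣ v ∩ w ∣ ≡ k ∸ 1

inner : ∀ {n} → Subset n → (Fin n → ℚ) → ℚ
inner []      c = 0ℚ
inner (b ∷ v) c = (if b then c zero else 0ℚ) ℚ.+ inner v (λ i → c (suc i))

StrictlyIncreasing : ∀ {n} → (Fin n → ℚ) → Set
StrictlyIncreasing c = ∀ i j → i Fin.< j → c i ℚ.< c j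

MonotoneStep : ∀ {n} → ℕ → (Fin n → ℚ) → Subset n → Subset n → Set
MonotoneStep k c v w = Adjacent k v w × (inner v c ℚ.< inner w c)

IsMonotonePath : (n k : ℕ) → (Fin n → ℚ) → List (Subset n) → Set
IsMonotonePath n k c vs =
  Σ (Subset n) λ v₁ → Σ (List (Subset n)) λ rest →
    (vs ≡ v₁ ∷ rest) ×
    (v₁ ≡ topVertex n k) ×
    (lastOf v₁ rest ≡ bottomVertex n k) ×
    All (IsVertex k) vs ×
    Linked (MonotoneStep k c) vs

EStep : ℕ → Set
EStep n = Fin n × Fin n × Subset n

-- enhanced step between consecutive vertices v, w:
-- x = the element of supp v ∖ supp w, y = the element of supp w ∖ supp v,
-- Z = supp v ∩ supp w.  (nothing only if the sets are empty, which
-- does not happen along a path)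
vStep : ∀ {n} → Subset n → Subset n → Maybe (EStep n)
vStep v w with findFirst (lookup (v ─ w)) | findFirst (lookup (w ─ v))
... | just x | just y = just (x , y , v ∩ w)
... | _      | _      = nothing

stepsWith : ∀ {a} {A : Set a} {n} → (A → A → Maybe (EStep n)) → List A → List (Maybe (EStep n))
stepsWith f []            = []
stepsWith f (x ∷ [])      = []
stepsWith f (x ∷ y ∷ xs)  = f x y ∷ stepsWith f (y ∷ xs)

Point : ℕ → ℕ → Set
Point n k = Vec (Fin n) k

DistinctCoords : ∀ {n k} → Point n k → Set
DistinctCoords ℓ = ∀ p q → lookup ℓ p ≡ lookup ℓ q → p ≡ q

LatticeStep : ∀ {n k} → Point n k → Point n k → Set
LatticeStep {k = k} ℓ ℓ' =
  Σ (Fin k) λ p → (lookup ℓ p Fin.< lookup ℓ' p) ×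
                  (∀ q → q ≢ p → lookup ℓ q ≡ lookup ℓ' q)

-- ℓ = (k, k-1, …, 1)  (0-based: (k-1,…,0))
IsStartPoint : ∀ {n k} → Point n k → Set
IsStartPoint {k = k} ℓ = Vec.toList (Vec.map toℕ ℓ) ≡ downFrom k

-- {ℓ_1,…,ℓ_k} = {n-k+1,…,n}  (0-based: {n-k,…,n-1})
IsEndPoint : ∀ {n k} → Point n k → Set
IsEndPoint {n} {k} ℓ = ∀ (i : Fin n) → (i ∈ ℓ → (n ∸ k) ℕ.≤ toℕ i) × ((n ∸ k) ℕ.≤ toℕ i → i ∈ ℓ)

IsDALP : (n k : ℕ) → List (Point n k) → Set
IsDALP n k ls =
  Σ (Point n k) λ ℓ₁ → Σ (List (Point n k)) λ rest →
    (ls ≡ ℓ₁ ∷ rest) ×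
    IsStartPoint ℓ₁ ×
    IsEndPoint (lastOf ℓ₁ rest) ×
    All DistinctCoords ls ×
    Linked LatticeStep ls

-- enhanced step of a lattice step: p = the coordinate that changes,
-- (ℓ_p → ℓ'_p ; {ℓ_q : q ≠ p})
lStep : ∀ {n k} → Point n k → Point n k → Maybe (EStep n)
lStep {n} {k} ℓ ℓ' with findFirst (λ q → not ⌊ lookup ℓ q Fin.≟ lookup ℓ' q ⌋)
... | nothing = nothing
... | just p  = just (lookup ℓ p , lookup ℓ' p ,
                      tabulate (λ i → anyFin (λ q → not ⌊ q Fin.≟ p ⌋ ∧ ⌊ lookup ℓ q Fin.≟ i ⌋)))

-- (k-1, …, 0) as a point, i.e. the paper's (k, …, 1)
startPt : (n k : ℕ) → k ℕ.≤ n → Point n k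
startPt n zero    _ = []
startPt n (suc k) p = fromℕ< p ∷ startPt n k (<⇒≤ p)

applyStep : ∀ {n k} → Maybe (EStep n) → Point n k → Point n k
applyStep nothing              ℓ = ℓ
applyStep (just (x , y , _))   ℓ = Vec.map (λ z → if ⌊ z Fin.≟ x ⌋ then y else z) ℓ

Lpts : ∀ {n k} → Point n k → List (Subset n) → List (Point n k)
Lpts ℓ []           = []
Lpts ℓ (v ∷ [])     = ℓ ∷ []
Lpts ℓ (v ∷ w ∷ vs) = ℓ ∷ Lpts (applyStep (vStep v w) ℓ) (w ∷ vs)

𝓛 : ∀ {n k} → k ℕ.≤ n → List (Subset n) → List (Point n k)
𝓛 {n} {k} k≤n vs = Lpts (startPt n k k≤n) vs

-- The inverse of 𝓛 is ℓ ↦ support ℓ, the set of coordinates of ℓ. Along 𝓛(P) the invariant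
-- support ℓᵢ = vᵢ holds: an edge v → w of Δ(n,k) exchanges one element x of v for one element y
-- outside v, and 𝓛 performs the same exchange on the coordinate of ℓᵢ equal to x. Since c is
-- strictly increasing, the edge increases ⟨·, c⟩ exactly when x < y, that is, exactly when the
-- exchange increases a coordinate. Conversely a lattice step between points with distinct
-- coordinates changes one coordinate, hence one element of the support.

module Submission where

open import Defs
open import Data.Nat using (ℕ; _≤_)
open import Data.Fin using (Fin)
open import Data.Fin.Subset using (Subset)
open import Data.Rational using (ℚ)
open import Data.List using (List)
open import Data.Product using (Σ; _×_)
open import Relation.Binary.PropositionalEquality using (_≡_)

open import Algebra.Bundles using (CommutativeMonoid)
open import Data.Bool using (Bool; true; false; T; not; _∧_; if_then_else_)
open import Data.Bool.Properties using (T-≡; T-∧; T-∨; ∧-zeroʳ; ∧-identityʳ)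
open import Data.Empty using (⊥-elim)
open import Data.Fin as Fin using (zero; suc; toℕ; _≟_)
open import Data.Fin.Properties using (toℕ-fromℕ<; toℕ-injective; suc-injective; <-cmp; <⇒≢)
open import Data.Fin.Subset using (⊥; ⁅_⁆; _∪_; _∩_; _─_; ∣_∣; _∈_; _∉_; _⊆_; inside; outside)
open import Data.Fin.Subset.Properties
  using (∉⊥; x∈⁅x⁆; x∈⁅y⁆⇒x≡y; ∣⊥∣≡0; ∣⁅x⁆∣≡1; ⊆-antisym; x∈p∩q⁺; x∈p∩q⁻; ∩-comm;
         x∈p∪q⁺; x∈p∪q⁻; ∪-identityˡ; p─q⊆p; x∈p∧x∉q⇒x∈p─q)
open import Data.List using ([]; _∷_; map)
import Data.List.Properties as List
open import Data.List.Relation.Unary.All using (All; []; _∷_)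
import Data.List.Relation.Unary.All as All
open import Data.List.Relation.Unary.All.Properties using (map⁺)
open import Data.List.Relation.Unary.Linked using (Linked; []; [-]; _∷_)
open import Data.Maybe using (just)
import Data.Nat as ℕ
open import Data.Nat.Properties
  using (≤ᵇ⇒≤; ≤⇒≤ᵇ; <ᵇ⇒<; <⇒<ᵇ; +-cancelˡ-≡; +-comm; +-suc; m+n∸n≡m; m<n⇒m<1+n; ≤∧≢⇒<; n<1+n)
  renaming (<-irrefl to ℕ-<-irrefl)
import Data.Rational as ℚ
open import Data.Rational using (0ℚ)
import Data.Rational.Properties as ℚ
open import Algebra.Properties.CommutativeSemigroup
  (CommutativeMonoid.commutativeSemigroup ℚ.+-0-commutativeMonoid) using (interchange)
open import Data.Product using (∃; _,_; proj₁; proj₂)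
import Data.Product as Product
open import Data.Sum using (inj₁; inj₂; [_,_]′)
open import Data.Vec using (Vec; []; _∷_; lookup; tabulate; here; there)
import Data.Vec as Vec
open import Data.Vec.Properties using ([]=⇒lookup; lookup⇒[]=; lookup∘tabulate; lookup-map; ∷-injectiveʳ)
open import Data.Vec.Relation.Binary.Pointwise.Extensional using (ext; Pointwise-≡⇒≡)
open import Data.Vec.Relation.Unary.Any as Any using (index)
open import Data.Vec.Relation.Unary.Any.Properties using (lookup-index)
open import Data.Vec.Membership.Propositional using () renaming (_∈_ to _∈ᵥ_; _∉_ to _∉ᵥ_)
open import Data.Vec.Membership.Propositional.Properties using (∈-lookup)
open import Function using (_∘_; id)
open import Function.Bundles using (module Equivalence)
open Equivalence using (to; from)
open import Relation.Binary.Definitions using (tri<; tri≈; tri>)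
open import Relation.Binary.PropositionalEquality
  using (refl; sym; trans; cong; cong₂; subst; subst₂; _≢_; module ≡-Reasoning)
open import Relation.Nullary using (yes; no; contradiction)
open import Relation.Nullary.Decidable
  using (⌊_⌋; toWitness; fromWitness; toWitnessFalse; fromWitnessFalse; decidable-stable)

private
  variable
    n k : ℕ

∣p∣≡0⇒p≡⊥ : (p : Subset n) → ∣ p ∣ ≡ 0 → p ≡ ⊥
∣p∣≡0⇒p≡⊥ []            _     = refl
∣p∣≡0⇒p≡⊥ (outside ∷ p) ∣p∣≡0 = cong (outside ∷_) (∣p∣≡0⇒p≡⊥ p ∣p∣≡0)

∣p∣≡1⇒p≡⁅x⁆ : (p : Subset n) → ∣ p ∣ ≡ 1 → ∃ λ x → p ≡ ⁅ x ⁆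
∣p∣≡1⇒p≡⁅x⁆ (inside  ∷ p) ∣p∣≡1 = zero , cong (inside ∷_) (∣p∣≡0⇒p≡⊥ p (cong ℕ.pred ∣p∣≡1))
∣p∣≡1⇒p≡⁅x⁆ (outside ∷ p) ∣p∣≡1 = Product.map suc (cong (outside ∷_)) (∣p∣≡1⇒p≡⁅x⁆ p ∣p∣≡1)

∣p∣≡∣p∩q∣+∣p─q∣ : (p q : Subset n) → ∣ p ∣ ≡ ∣ p ∩ q ∣ ℕ.+ ∣ p ─ q ∣
∣p∣≡∣p∩q∣+∣p─q∣ []            []            = refl
∣p∣≡∣p∩q∣+∣p─q∣ (inside  ∷ p) (inside  ∷ q) = cong ℕ.suc (∣p∣≡∣p∩q∣+∣p─q∣ p q)
∣p∣≡∣p∩q∣+∣p─q∣ (inside  ∷ p) (outside ∷ q) = trans (cong ℕ.suc (∣p∣≡∣p∩q∣+∣p─q∣ p q)) (sym (+-suc _ _))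
∣p∣≡∣p∩q∣+∣p─q∣ (outside ∷ p) (inside  ∷ q) = ∣p∣≡∣p∩q∣+∣p─q∣ p q
∣p∣≡∣p∩q∣+∣p─q∣ (outside ∷ p) (outside ∷ q) = ∣p∣≡∣p∩q∣+∣p─q∣ p q

x∉p⇒∣⁅x⁆∪p∣≡1+∣p∣ : {x : Fin n} {p : Subset n} → x ∉ p → ∣ ⁅ x ⁆ ∪ p ∣ ≡ ℕ.suc ∣ p ∣
x∉p⇒∣⁅x⁆∪p∣≡1+∣p∣ {x = zero}  {outside ∷ p} _   = cong (ℕ.suc ∘ ∣_∣) (∪-identityˡ p)
x∉p⇒∣⁅x⁆∪p∣≡1+∣p∣ {x = zero}  {inside  ∷ p} x∉p = contradiction here x∉p
x∉p⇒∣⁅x⁆∪p∣≡1+∣p∣ {x = suc x} {outside ∷ p} x∉p = x∉p⇒∣⁅x⁆∪p∣≡1+∣p∣ (x∉p ∘ there)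
x∉p⇒∣⁅x⁆∪p∣≡1+∣p∣ {x = suc x} {inside  ∷ p} x∉p = cong ℕ.suc (x∉p⇒∣⁅x⁆∪p∣≡1+∣p∣ (x∉p ∘ there))

x∈p─q⇒x∉q : {x : Fin n} (p q : Subset n) → x ∈ p ─ q → x ∉ q
x∈p─q⇒x∉q (_ ∷ p) (outside ∷ q) here          ()
x∈p─q⇒x∉q (_ ∷ p) (_       ∷ q) (there x∈p─q) (there x∈q) = x∈p─q⇒x∉q p q x∈p─q x∈q

p─q≡p─r∧q─p≡r─p⇒q≡r : (p q r : Subset n) → p ─ q ≡ p ─ r → q ─ p ≡ r ─ p → q ≡ r
p─q≡p─r∧q─p≡r─p⇒q≡r []            []            []            _  _ = refl
p─q≡p─r∧q─p≡r─p⇒q≡r (_ ∷ p)       (inside  ∷ q) (inside  ∷ r) e e′ =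
  cong (inside ∷_) (p─q≡p─r∧q─p≡r─p⇒q≡r p q r (∷-injectiveʳ e) (∷-injectiveʳ e′))
p─q≡p─r∧q─p≡r─p⇒q≡r (_ ∷ p)       (outside ∷ q) (outside ∷ r) e e′ =
  cong (outside ∷_) (p─q≡p─r∧q─p≡r─p⇒q≡r p q r (∷-injectiveʳ e) (∷-injectiveʳ e′))
p─q≡p─r∧q─p≡r─p⇒q≡r (inside  ∷ p) (inside  ∷ q) (outside ∷ r) () _
p─q≡p─r∧q─p≡r─p⇒q≡r (outside ∷ p) (inside  ∷ q) (outside ∷ r) _  ()
p─q≡p─r∧q─p≡r─p⇒q≡r (inside  ∷ p) (outside ∷ q) (inside  ∷ r) () _
p─q≡p─r∧q─p≡r─p⇒q≡r (outside ∷ p) (outside ∷ q) (inside  ∷ r) _  ()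

∈⇒T-lookup : {i : Fin n} {p : Subset n} → i ∈ p → T (lookup p i)
∈⇒T-lookup i∈p = from T-≡ ([]=⇒lookup i∈p)

T-lookup⇒∈ : {i : Fin n} {p : Subset n} → T (lookup p i) → i ∈ p
T-lookup⇒∈ {i = i} t = lookup⇒[]= i _ (to T-≡ t)

∈-tabulate⁺ : {f : Fin n → Bool} {i : Fin n} → T (f i) → i ∈ tabulate f
∈-tabulate⁺ {f = f} {i} t = T-lookup⇒∈ (subst T (sym (lookup∘tabulate f i)) t)

∈-tabulate⁻ : {f : Fin n → Bool} {i : Fin n} → i ∈ tabulate f → T (f i)
∈-tabulate⁻ {f = f} {i} i∈ = subst T (lookup∘tabulate f i) (∈⇒T-lookup i∈)

-- Inner products

∷-─-∷ : ∀ a b (p q : Subset n) → (a ∷ p) ─ (b ∷ q) ≡ (a ∧ not b) ∷ (p ─ q)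
∷-─-∷ a inside  p q = cong (_∷ (p ─ q)) (sym (∧-zeroʳ a))
∷-─-∷ a outside p q = cong (_∷ (p ─ q)) (sym (∧-identityʳ a))

if-split : ∀ a b (x : ℚ) →
           (if a then x else 0ℚ) ≡ (if a ∧ b then x else 0ℚ) ℚ.+ (if a ∧ not b then x else 0ℚ)
if-split true  true  x = sym (ℚ.+-identityʳ x)
if-split true  false x = sym (ℚ.+-identityˡ x)
if-split false _     _ = sym (ℚ.+-identityˡ 0ℚ)

inner-∩-─ : (p q : Subset n) (c : Fin n → ℚ) → inner p c ≡ inner (p ∩ q) c ℚ.+ inner (p ─ q) c
inner-∩-─ []      []      c = sym (ℚ.+-identityˡ 0ℚ)
inner-∩-─ (a ∷ p) (b ∷ q) c = begin
  (if a then c zero else 0ℚ) ℚ.+ inner p (c ∘ suc)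
    ≡⟨ cong₂ ℚ._+_ (if-split a b (c zero)) (inner-∩-─ p q (c ∘ suc)) ⟩
  ((if a ∧ b then c zero else 0ℚ) ℚ.+ (if a ∧ not b then c zero else 0ℚ)) ℚ.+
    (inner (p ∩ q) (c ∘ suc) ℚ.+ inner (p ─ q) (c ∘ suc))
    ≡⟨ interchange (if a ∧ b then c zero else 0ℚ) (if a ∧ not b then c zero else 0ℚ)
                   (inner (p ∩ q) (c ∘ suc)) (inner (p ─ q) (c ∘ suc)) ⟩
  inner ((a ∧ b) ∷ (p ∩ q)) c ℚ.+ inner ((a ∧ not b) ∷ (p ─ q)) c
    ≡⟨ cong (λ s → inner ((a ∷ p) ∩ (b ∷ q)) c ℚ.+ inner s c) (∷-─-∷ a b p q) ⟨
  inner ((a ∷ p) ∩ (b ∷ q)) c ℚ.+ inner ((a ∷ p) ─ (b ∷ q)) c ∎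
  where open ≡-Reasoning

inner-⊥ : (c : Fin n → ℚ) → inner ⊥ c ≡ 0ℚ
inner-⊥ {ℕ.zero}  c = refl
inner-⊥ {ℕ.suc n} c = trans (ℚ.+-identityˡ _) (inner-⊥ (c ∘ suc))

inner-⁅x⁆ : (x : Fin n) (c : Fin n → ℚ) → inner ⁅ x ⁆ c ≡ c x
inner-⁅x⁆ zero    c = trans (cong (c zero ℚ.+_) (inner-⊥ (c ∘ suc))) (ℚ.+-identityʳ _)
inner-⁅x⁆ (suc x) c = trans (ℚ.+-identityˡ _) (inner-⁅x⁆ x (c ∘ suc))

inner-exchange : {v w : Subset n} {x y : Fin n} (c : Fin n → ℚ) → v ─ w ≡ ⁅ x ⁆ → w ─ v ≡ ⁅ y ⁆ →
                 inner v c ≡ inner (v ∩ w) c ℚ.+ c x × inner w c ≡ inner (v ∩ w) c ℚ.+ c y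
inner-exchange {v = v} {w} {x} {y} c v─w≡x w─v≡y =
  removing v─w≡x , trans (removing w─v≡y) (cong (λ s → inner s c ℚ.+ c y) (∩-comm w v))
  where
  removing : ∀ {p q z} → p ─ q ≡ ⁅ z ⁆ → inner p c ≡ inner (p ∩ q) c ℚ.+ c z
  removing {p} {q} {z} e =
    trans (inner-∩-─ p q c) (cong (inner (p ∩ q) c ℚ.+_) (trans (cong (λ s → inner s c) e) (inner-⁅x⁆ z c)))

+-cancelˡ-< : ∀ z {p q : ℚ} → z ℚ.+ p ℚ.< z ℚ.+ q → p ℚ.< q
+-cancelˡ-< z lt = ℚ.≰⇒> λ q≤p → ℚ.<-irrefl refl (ℚ.<-≤-trans lt (ℚ.+-monoʳ-≤ z q≤p))

module _ {c : Fin n → ℚ} (c-increasing : StrictlyIncreasing c) where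

  increasing⇒reflects-< : {x y : Fin n} → c x ℚ.< c y → x Fin.< y
  increasing⇒reflects-< {x} {y} cx<cy with <-cmp x y
  ... | tri< x<y _ _ = x<y
  ... | tri≈ _ refl _ = contradiction cx<cy (ℚ.<-irrefl refl)
  ... | tri> _ _ y<x = contradiction cx<cy (ℚ.<-asym (c-increasing y x y<x))

  inner-<⇒< : {v w : Subset n} {x y : Fin n} → v ─ w ≡ ⁅ x ⁆ → w ─ v ≡ ⁅ y ⁆ →
              inner v c ℚ.< inner w c → x Fin.< y
  inner-<⇒< {v} {w} v─w≡x w─v≡y lt =
    let iv , iw = inner-exchange c v─w≡x w─v≡y in
    increasing⇒reflects-< (+-cancelˡ-< (inner (v ∩ w) c) (subst₂ ℚ._<_ iv iw lt))

  <⇒inner-< : {v w : Subset n} {x y : Fin n} → v ─ w ≡ ⁅ x ⁆ → w ─ v ≡ ⁅ y ⁆ →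
              x Fin.< y → inner v c ℚ.< inner w c
  <⇒inner-< {v} {w} v─w≡x w─v≡y x<y =
    let iv , iw = inner-exchange c v─w≡x w─v≡y in
    subst₂ ℚ._<_ (sym iv) (sym iw) (ℚ.+-monoʳ-< (inner (v ∩ w) c) (c-increasing _ _ x<y))

-- The support of a point

support : Point n k → Subset n
support []      = ⊥
support (x ∷ ℓ) = ⁅ x ⁆ ∪ support ℓ

∈-support⁺ : {i : Fin n} {ℓ : Point n k} → i ∈ᵥ ℓ → i ∈ support ℓ
∈-support⁺ (Any.here refl)  = x∈p∪q⁺ (inj₁ (x∈⁅x⁆ _))
∈-support⁺ (Any.there i∈ℓ) = x∈p∪q⁺ (inj₂ (∈-support⁺ i∈ℓ))

∈-support⁻ : {i : Fin n} (ℓ : Point n k) → i ∈ support ℓ → i ∈ᵥ ℓ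
∈-support⁻ []      i∈⊥ = ⊥-elim (∉⊥ i∈⊥)
∈-support⁻ (x ∷ ℓ) i∈  =
  [ Any.here ∘ x∈⁅y⁆⇒x≡y x , Any.there ∘ ∈-support⁻ ℓ ]′ (x∈p∪q⁻ ⁅ x ⁆ (support ℓ) i∈)

lookup∈support : (ℓ : Point n k) (q : Fin k) → lookup ℓ q ∈ support ℓ
lookup∈support ℓ q = ∈-support⁺ (∈-lookup q ℓ)

∈support⇒lookup : {i : Fin n} (ℓ : Point n k) → i ∈ support ℓ → ∃ λ q → lookup ℓ q ≡ i
∈support⇒lookup ℓ i∈ = let i∈ℓ = ∈-support⁻ ℓ i∈ in index i∈ℓ , sym (lookup-index i∈ℓ)

DistinctCoords-∷⁺ : {x : Fin n} {ℓ : Point n k} → x ∉ᵥ ℓ → DistinctCoords ℓ → DistinctCoords (x ∷ ℓ)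
DistinctCoords-∷⁺         x∉ℓ dℓ zero    zero     _ = refl
DistinctCoords-∷⁺ {ℓ = ℓ} x∉ℓ dℓ zero    (suc q′) e = ⊥-elim (x∉ℓ (subst (_∈ᵥ ℓ) (sym e) (∈-lookup q′ ℓ)))
DistinctCoords-∷⁺ {ℓ = ℓ} x∉ℓ dℓ (suc q) zero     e = ⊥-elim (x∉ℓ (subst (_∈ᵥ ℓ) e (∈-lookup q ℓ)))
DistinctCoords-∷⁺         x∉ℓ dℓ (suc q) (suc q′) e = cong suc (dℓ q q′ e)

DistinctCoords-∷⁻ : {x : Fin n} {ℓ : Point n k} → DistinctCoords (x ∷ ℓ) → x ∉ᵥ ℓ × DistinctCoords ℓ
DistinctCoords-∷⁻ d = (λ x∈ℓ → contradiction (d zero (suc (index x∈ℓ)) (lookup-index x∈ℓ)) λ ())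
                    , λ q q′ e → suc-injective (d (suc q) (suc q′) e)

∣support∣≡k : (ℓ : Point n k) → DistinctCoords ℓ → ∣ support ℓ ∣ ≡ k
∣support∣≡k {n} []      _ = ∣⊥∣≡0 n
∣support∣≡k     (x ∷ ℓ) d =
  let x∉ℓ , dℓ = DistinctCoords-∷⁻ d in
  trans (x∉p⇒∣⁅x⁆∪p∣≡1+∣p∣ (x∉ℓ ∘ ∈-support⁻ ℓ)) (cong ℕ.suc (∣support∣≡k ℓ dℓ))

T-anyFin⁺ : ∀ {m} (f : Fin m → Bool) q → T (f q) → T (anyFin f)
T-anyFin⁺ f zero    t = from T-∨ (inj₁ t)
T-anyFin⁺ f (suc q) t = from (T-∨ {f zero}) (inj₂ (T-anyFin⁺ (f ∘ suc) q t))

T-anyFin⁻ : ∀ {m} (f : Fin m → Bool) → T (anyFin f) → ∃ λ q → T (f q)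
T-anyFin⁻ {ℕ.suc m} f t with to (T-∨ {f zero}) t
... | inj₁ t₀ = zero , t₀
... | inj₂ t′ = Product.map suc id (T-anyFin⁻ (f ∘ suc) t′)

findFirst-unique : ∀ {m} (f : Fin m → Bool) {p} → T (f p) → (∀ q → T (f q) → q ≡ p) → findFirst f ≡ just p
findFirst-unique {ℕ.suc m} f {p} fp unique with f zero in f₀
... | true  = cong just (unique zero (subst T (sym f₀) _))
... | false with p
...   | zero  = contradiction (subst T f₀ fp) id
...   | suc p
  rewrite findFirst-unique (λ i → f (suc i)) fp (λ q fq → suc-injective (unique (suc q) fq)) = refl

findFirst-⁅x⁆ : (x : Fin n) → findFirst (lookup ⁅ x ⁆) ≡ just x
findFirst-⁅x⁆ x = findFirst-unique (lookup ⁅ x ⁆) (∈⇒T-lookup (x∈⁅x⁆ x)) (λ q t → x∈⁅y⁆⇒x≡y x (T-lookup⇒∈ t))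

vStep-⁅⁆ : {v w : Subset n} {x y : Fin n} → v ─ w ≡ ⁅ x ⁆ → w ─ v ≡ ⁅ y ⁆ → vStep v w ≡ just (x , y , v ∩ w)
vStep-⁅⁆ {x = x} {y} v─w≡x w─v≡y rewrite v─w≡x | w─v≡y | findFirst-⁅x⁆ x | findFirst-⁅x⁆ y = refl

-- Points differing in a single coordinate

record ChangesOnly (p : Fin k) (ℓ ℓ′ : Point n k) : Set where
  constructor _,_
  field
    changed   : lookup ℓ p ≢ lookup ℓ′ p
    unchanged : ∀ q → q ≢ p → lookup ℓ q ≡ lookup ℓ′ q

ChangesOnly-sym : {p : Fin k} {ℓ ℓ′ : Point n k} → ChangesOnly p ℓ ℓ′ → ChangesOnly p ℓ′ ℓ
ChangesOnly-sym (ne , agree) = ne ∘ sym , λ q q≢p → sym (agree q q≢p)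

module _ (ℓ ℓ′ : Point n k) {p : Fin k} (dℓ : DistinctCoords ℓ) (changes : ChangesOnly p ℓ ℓ′) where

  open ChangesOnly changes renaming (changed to ne; unchanged to agree)

  private
    differs⇒≡p : ∀ q → T (not ⌊ lookup ℓ q ≟ lookup ℓ′ q ⌋) → q ≡ p
    differs⇒≡p q t = decidable-stable (q ≟ p) (λ q≢p → toWitnessFalse t (agree q q≢p))

  changed∉support : lookup ℓ p ∉ support ℓ′
  changed∉support ℓp∈ with ∈support⇒lookup ℓ′ ℓp∈
  ... | q , ℓ′q≡ℓp with q ≟ p
  ...   | yes refl = ne (sym ℓ′q≡ℓp)
  ...   | no  q≢p  = q≢p (dℓ q p (trans (agree q q≢p) ℓ′q≡ℓp))

  support-─ : support ℓ ─ support ℓ′ ≡ ⁅ lookup ℓ p ⁆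
  support-─ = ⊆-antisym ⊆⁅ℓp⁆ ⁅ℓp⁆⊆
    where
    ⊆⁅ℓp⁆ : support ℓ ─ support ℓ′ ⊆ ⁅ lookup ℓ p ⁆
    ⊆⁅ℓp⁆ i∈ with ∈support⇒lookup ℓ (p─q⊆p _ _ i∈)
    ... | q , refl with q ≟ p
    ...   | yes refl = x∈⁅x⁆ _
    ...   | no  q≢p  = contradiction (subst (_∈ support ℓ′) (sym (agree q q≢p)) (lookup∈support ℓ′ q))
                                     (x∈p─q⇒x∉q (support ℓ) (support ℓ′) i∈)
    ⁅ℓp⁆⊆ : ⁅ lookup ℓ p ⁆ ⊆ support ℓ ─ support ℓ′
    ⁅ℓp⁆⊆ i∈ with x∈⁅y⁆⇒x≡y _ i∈
    ... | refl = x∈p∧x∉q⇒x∈p─q (lookup∈support ℓ p) changed∉support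

  lStep-changesOnly : lStep ℓ ℓ′ ≡ just (lookup ℓ p , lookup ℓ′ p , support ℓ ∩ support ℓ′)
  lStep-changesOnly
    rewrite findFirst-unique (λ q → not ⌊ lookup ℓ q ≟ lookup ℓ′ q ⌋) (fromWitnessFalse ne) differs⇒≡p
    = cong (λ Z → just (lookup ℓ p , lookup ℓ′ p , Z)) (⊆-antisym ⊆∩ ∩⊆)
    where
    Z : Subset n
    Z = tabulate (λ i → anyFin (λ q → not ⌊ q ≟ p ⌋ ∧ ⌊ lookup ℓ q ≟ i ⌋))

    ⊆∩ : Z ⊆ support ℓ ∩ support ℓ′
    ⊆∩ {i} i∈ with T-anyFin⁻ _ (∈-tabulate⁻ i∈)
    ... | q , t with to T-∧ t
    ...   | q≢p , ℓq≡i with toWitness {a? = lookup ℓ q ≟ i} ℓq≡i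
    ...     | refl = x∈p∩q⁺
      (lookup∈support ℓ q , subst (_∈ support ℓ′) (sym (agree q (toWitnessFalse q≢p))) (lookup∈support ℓ′ q))

    ∩⊆ : support ℓ ∩ support ℓ′ ⊆ Z
    ∩⊆ i∈ with x∈p∩q⁻ (support ℓ) (support ℓ′) i∈
    ... | i∈ℓ , i∈ℓ′ with ∈support⇒lookup ℓ i∈ℓ
    ...   | q , refl = ∈-tabulate⁺ (T-anyFin⁺ _ q (from T-∧ ( fromWitnessFalse {a? = q ≟ p} q≢p
                                                         , fromWitness {a? = lookup ℓ q ≟ lookup ℓ q} refl)))
      where
      q≢p : q ≢ p
      q≢p refl = changed∉support i∈ℓ′

exchange : Fin n → Fin n → Fin n → Fin n
exchange x y z = if ⌊ z ≟ x ⌋ then y else z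

-- applyStep (just (x , y , Z)) reduces to replace x y.
replace : Fin n → Fin n → Point n k → Point n k
replace x y = Vec.map (exchange x y)

exchange-≡ : {x y z : Fin n} → z ≡ x → exchange x y z ≡ y
exchange-≡ {x = x} {z = z} z≡x with z ≟ x
... | yes _   = refl
... | no z≢x = contradiction z≡x z≢x

exchange-≢ : {x y z : Fin n} → z ≢ x → exchange x y z ≡ z
exchange-≢ {x = x} {z = z} z≢x with z ≟ x
... | yes z≡x = contradiction z≡x z≢x
... | no _    = refl

module _ (ℓ : Point n k) {p : Fin k} {y : Fin n} where

  lookup-replace-at : lookup (replace (lookup ℓ p) y ℓ) p ≡ y
  lookup-replace-at = trans (lookup-map p _ ℓ) (exchange-≡ {x = lookup ℓ p} refl)

  lookup-replace-off : DistinctCoords ℓ → {q : Fin k} → q ≢ p →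
                       lookup (replace (lookup ℓ p) y ℓ) q ≡ lookup ℓ q
  lookup-replace-off dℓ {q} q≢p =
    trans (lookup-map q _ ℓ) (exchange-≢ (q≢p ∘ dℓ q p))

  module _ (dℓ : DistinctCoords ℓ) (y∉ℓ : y ∉ support ℓ) where

    private
      y≢ℓ : ∀ q → y ≢ lookup ℓ q
      y≢ℓ q y≡ℓq = y∉ℓ (subst (_∈ support ℓ) (sym y≡ℓq) (lookup∈support ℓ q))

    replace-changesOnly : ChangesOnly p ℓ (replace (lookup ℓ p) y ℓ)
    replace-changesOnly = (λ e → y≢ℓ p (sym (trans e lookup-replace-at)))
                        , λ q q≢p → sym (lookup-replace-off dℓ q≢p)

    replace-distinct : DistinctCoords (replace (lookup ℓ p) y ℓ)
    replace-distinct q q′ e with q ≟ p | q′ ≟ p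
    ... | yes refl | yes refl = refl
    ... | yes refl | no q′≢p  =
      contradiction (trans (sym lookup-replace-at) (trans e (lookup-replace-off dℓ q′≢p))) (y≢ℓ q′)
    ... | no q≢p   | yes refl =
      contradiction (trans (sym lookup-replace-at) (trans (sym e) (lookup-replace-off dℓ q≢p))) (y≢ℓ q)
    ... | no q≢p   | no q′≢p  =
      dℓ q q′ (trans (sym (lookup-replace-off dℓ q≢p)) (trans e (lookup-replace-off dℓ q′≢p)))

replace-changed : (ℓ ℓ′ : Point n k) {p : Fin k} → DistinctCoords ℓ → ChangesOnly p ℓ ℓ′ →
                  replace (lookup ℓ p) (lookup ℓ′ p) ℓ ≡ ℓ′
replace-changed ℓ ℓ′ {p} dℓ (_ , agree) = Pointwise-≡⇒≡ (ext pointwise)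
  where
  pointwise : ∀ q → lookup (replace (lookup ℓ p) (lookup ℓ′ p) ℓ) q ≡ lookup ℓ′ q
  pointwise q with q ≟ p
  ... | yes refl = lookup-replace-at ℓ
  ... | no  q≢p  = trans (lookup-replace-off ℓ dℓ q≢p) (agree q q≢p)

-- Edges of Δ(n,k) and lattice steps

adjacent⇒∣p─q∣≡1 : (v w : Subset n) → 1 ≤ k → ∣ v ∣ ≡ k → Adjacent k v w → ∣ v ─ w ∣ ≡ 1
adjacent⇒∣p─q∣≡1 {k = ℕ.suc k} v w _ ∣v∣≡k adj = +-cancelˡ-≡ k _ _ (begin
  k ℕ.+ ∣ v ─ w ∣             ≡⟨ cong (ℕ._+ ∣ v ─ w ∣) adj ⟨
  ∣ v ∩ w ∣ ℕ.+ ∣ v ─ w ∣     ≡⟨ ∣p∣≡∣p∩q∣+∣p─q∣ v w ⟨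
  ∣ v ∣                       ≡⟨ ∣v∣≡k ⟩
  ℕ.suc k                     ≡⟨ +-comm 1 k ⟩
  k ℕ.+ 1                     ∎)
  where open ≡-Reasoning

∣p─q∣≡1⇒adjacent : (v w : Subset n) → ∣ v ∣ ≡ k → ∣ v ─ w ∣ ≡ 1 → Adjacent k v w
∣p─q∣≡1⇒adjacent {k = k} v w ∣v∣≡k ∣v─w∣≡1 = begin
  ∣ v ∩ w ∣                       ≡⟨ m+n∸n≡m ∣ v ∩ w ∣ 1 ⟨
  ∣ v ∩ w ∣ ℕ.+ 1 ℕ.∸ 1           ≡⟨ cong (λ d → ∣ v ∩ w ∣ ℕ.+ d ℕ.∸ 1) ∣v─w∣≡1 ⟨
  ∣ v ∩ w ∣ ℕ.+ ∣ v ─ w ∣ ℕ.∸ 1   ≡⟨ cong (ℕ._∸ 1) (∣p∣≡∣p∩q∣+∣p─q∣ v w) ⟨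
  ∣ v ∣ ℕ.∸ 1                     ≡⟨ cong (ℕ._∸ 1) ∣v∣≡k ⟩
  k ℕ.∸ 1                         ∎
  where open ≡-Reasoning

adjacent-sym : (v w : Subset n) → Adjacent k v w → Adjacent k w v
adjacent-sym v w adj = trans (cong ∣_∣ (∩-comm w v)) adj

module _ {c : Fin n → ℚ} (c-increasing : StrictlyIncreasing c) where

  module _ (ℓ : Point n k) (w : Subset n) {p : Fin k} {y : Fin n} (dℓ : DistinctCoords ℓ)
           (ℓ─w : support ℓ ─ w ≡ ⁅ lookup ℓ p ⁆) (w─ℓ : w ─ support ℓ ≡ ⁅ y ⁆) where

    private
      ℓ′ : Point n k
      ℓ′ = replace (lookup ℓ p) y ℓ

      y∉ℓ : y ∉ support ℓ
      y∉ℓ = x∈p─q⇒x∉q w (support ℓ) (subst (y ∈_) (sym w─ℓ) (x∈⁅x⁆ y))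

      changes : ChangesOnly p ℓ ℓ′
      changes = replace-changesOnly ℓ dℓ y∉ℓ

      dℓ′ : DistinctCoords ℓ′
      dℓ′ = replace-distinct ℓ dℓ y∉ℓ

    support-replace : support ℓ′ ≡ w
    support-replace = p─q≡p─r∧q─p≡r─p⇒q≡r (support ℓ) (support ℓ′) w
      (trans (support-─ ℓ ℓ′ dℓ changes) (sym ℓ─w))
      (trans (support-─ ℓ′ ℓ dℓ′ (ChangesOnly-sym changes))
             (trans (cong ⁅_⁆ (lookup-replace-at ℓ)) (sym w─ℓ)))

    replace-latticeStep : inner (support ℓ) c ℚ.< inner w c →
      DistinctCoords ℓ′ × LatticeStep ℓ ℓ′ × lStep ℓ ℓ′ ≡ just (lookup ℓ p , y , support ℓ ∩ w)
    replace-latticeStep increases =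
        dℓ′
      , (p , subst (lookup ℓ p Fin.<_) (sym (lookup-replace-at ℓ)) (inner-<⇒< c-increasing ℓ─w w─ℓ increases)
           , ChangesOnly.unchanged changes)
      , trans (lStep-changesOnly ℓ ℓ′ dℓ changes)
              (cong₂ (λ y Z → just (lookup ℓ p , y , Z))
                     (lookup-replace-at ℓ) (cong (support ℓ ∩_) support-replace))

  monotoneStep⇒latticeStep : (ℓ : Point n k) (w : Subset n) → 1 ≤ k → DistinctCoords ℓ → IsVertex k w →
    MonotoneStep k c (support ℓ) w →
    let ℓ′ = applyStep (vStep (support ℓ) w) ℓ in
    support ℓ′ ≡ w × DistinctCoords ℓ′ × LatticeStep ℓ ℓ′ × lStep ℓ ℓ′ ≡ vStep (support ℓ) w
  monotoneStep⇒latticeStep {k = k} ℓ w 1≤k dℓ w-vertex (adj , increases)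
    with ∣p∣≡1⇒p≡⁅x⁆ _ (adjacent⇒∣p─q∣≡1 (support ℓ) w 1≤k (∣support∣≡k ℓ dℓ) adj)
       | ∣p∣≡1⇒p≡⁅x⁆ _ (adjacent⇒∣p─q∣≡1 w (support ℓ) 1≤k w-vertex (adjacent-sym {k = k} (support ℓ) w adj))
  ... | x , ℓ─w | y , w─ℓ with ∈support⇒lookup ℓ (p─q⊆p (support ℓ) w (subst (x ∈_) (sym ℓ─w) (x∈⁅x⁆ x)))
  ... | p , refl rewrite vStep-⁅⁆ ℓ─w w─ℓ =
    support-replace ℓ w dℓ ℓ─w w─ℓ , replace-latticeStep ℓ w dℓ ℓ─w w─ℓ increases

  latticeStep⇒monotoneStep : (ℓ ℓ′ : Point n k) → DistinctCoords ℓ → DistinctCoords ℓ′ → LatticeStep ℓ ℓ′ →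
    MonotoneStep k c (support ℓ) (support ℓ′) × applyStep (vStep (support ℓ) (support ℓ′)) ℓ ≡ ℓ′
  latticeStep⇒monotoneStep ℓ ℓ′ dℓ dℓ′ (p , ℓp<ℓ′p , agree) =
      ( ∣p─q∣≡1⇒adjacent (support ℓ) (support ℓ′) (∣support∣≡k ℓ dℓ)
          (trans (cong ∣_∣ ℓ─ℓ′) (∣⁅x⁆∣≡1 (lookup ℓ p)))
      , <⇒inner-< c-increasing ℓ─ℓ′ ℓ′─ℓ ℓp<ℓ′p)
    , subst (λ s → applyStep s ℓ ≡ ℓ′) (sym (vStep-⁅⁆ ℓ─ℓ′ ℓ′─ℓ)) (replace-changed ℓ ℓ′ dℓ changes)
    where
    changes : ChangesOnly p ℓ ℓ′
    changes = <⇒≢ ℓp<ℓ′p , agree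
    ℓ─ℓ′ : support ℓ ─ support ℓ′ ≡ ⁅ lookup ℓ p ⁆
    ℓ─ℓ′ = support-─ ℓ ℓ′ dℓ changes
    ℓ′─ℓ : support ℓ′ ─ support ℓ ≡ ⁅ lookup ℓ′ p ⁆
    ℓ′─ℓ = support-─ ℓ′ ℓ dℓ′ (ChangesOnly-sym changes)

∈-topVertex⁺ : {i : Fin n} → toℕ i ℕ.< k → i ∈ topVertex n k
∈-topVertex⁺ i<k = ∈-tabulate⁺ (<⇒<ᵇ i<k)

∈-topVertex⁻ : {i : Fin n} → i ∈ topVertex n k → toℕ i ℕ.< k
∈-topVertex⁻ i∈ = <ᵇ⇒< _ _ (∈-tabulate⁻ i∈)

∈-bottomVertex⁺ : {i : Fin n} → n ℕ.∸ k ℕ.≤ toℕ i → i ∈ bottomVertex n k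
∈-bottomVertex⁺ n-k≤i = ∈-tabulate⁺ (≤⇒≤ᵇ n-k≤i)

∈-bottomVertex⁻ : {i : Fin n} → i ∈ bottomVertex n k → n ℕ.∸ k ℕ.≤ toℕ i
∈-bottomVertex⁻ i∈ = ≤ᵇ⇒≤ _ _ (∈-tabulate⁻ i∈)

∈-startPt⁻ : (k : ℕ) (k≤n : k ≤ n) {i : Fin n} → i ∈ᵥ startPt n k k≤n → toℕ i ℕ.< k
∈-startPt⁻ (ℕ.suc k) k<n (Any.here refl) = subst (ℕ._< ℕ.suc k) (sym (toℕ-fromℕ< k<n)) (n<1+n k)
∈-startPt⁻ (ℕ.suc k) k<n (Any.there i∈) = m<n⇒m<1+n (∈-startPt⁻ k _ i∈)

∈-startPt⁺ : (k : ℕ) (k≤n : k ≤ n) {i : Fin n} → toℕ i ℕ.< k → i ∈ᵥ startPt n k k≤n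
∈-startPt⁺ (ℕ.suc k) k<n {i} i<1+k with toℕ i ℕ.≟ k
... | yes i≡k = Any.here (toℕ-injective (trans i≡k (sym (toℕ-fromℕ< k<n))))
... | no  i≢k = Any.there (∈-startPt⁺ k _ (≤∧≢⇒< (ℕ.s≤s⁻¹ i<1+k) i≢k))

startPt-distinct : (k : ℕ) (k≤n : k ≤ n) → DistinctCoords (startPt n k k≤n)
startPt-distinct ℕ.zero    _   ()
startPt-distinct (ℕ.suc k) k<n =
  DistinctCoords-∷⁺ (λ k∈ → ℕ-<-irrefl (toℕ-fromℕ< k<n) (∈-startPt⁻ k _ k∈)) (startPt-distinct k _)

startPt-isStartPoint : (k : ℕ) (k≤n : k ≤ n) → IsStartPoint (startPt n k k≤n)
startPt-isStartPoint ℕ.zero    _   = refl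
startPt-isStartPoint (ℕ.suc k) k<n = cong₂ _∷_ (toℕ-fromℕ< k<n) (startPt-isStartPoint k _)

isStartPoint⇒≡startPt : (k : ℕ) (k≤n : k ≤ n) (ℓ : Point n k) → IsStartPoint ℓ → ℓ ≡ startPt n k k≤n
isStartPoint⇒≡startPt ℕ.zero    _   []      _ = refl
isStartPoint⇒≡startPt (ℕ.suc k) k<n (x ∷ ℓ) e =
  cong₂ _∷_ (toℕ-injective (trans (List.∷-injectiveˡ e) (sym (toℕ-fromℕ< k<n))))
            (isStartPoint⇒≡startPt k _ ℓ (List.∷-injectiveʳ e))

support-startPt : (k : ℕ) (k≤n : k ≤ n) → support (startPt n k k≤n) ≡ topVertex n k
support-startPt k k≤n = ⊆-antisym
  (λ i∈ → ∈-topVertex⁺ (∈-startPt⁻ k k≤n (∈-support⁻ _ i∈)))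
  (λ i∈ → ∈-support⁺ (∈-startPt⁺ k k≤n (∈-topVertex⁻ i∈)))

support≡bottom⇒isEndPoint : (ℓ : Point n k) → support ℓ ≡ bottomVertex n k → IsEndPoint ℓ
support≡bottom⇒isEndPoint {k = k} ℓ ℓ≡bottom i =
    (λ i∈ℓ → ∈-bottomVertex⁻ {k = k} (subst (i ∈_) ℓ≡bottom (∈-support⁺ i∈ℓ)))
  , (λ n-k≤i → ∈-support⁻ ℓ (subst (i ∈_) (sym ℓ≡bottom) (∈-bottomVertex⁺ {k = k} n-k≤i)))

isEndPoint⇒support≡bottom : (ℓ : Point n k) → IsEndPoint ℓ → support ℓ ≡ bottomVertex n k
isEndPoint⇒support≡bottom {k = k} ℓ end = ⊆-antisym
  (λ {i} i∈ → ∈-bottomVertex⁺ {k = k} (proj₁ (end i) (∈-support⁻ ℓ i∈)))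
  (λ {i} i∈ → ∈-support⁺ (proj₂ (end i) (∈-bottomVertex⁻ {k = k} i∈)))

lastOf-map : {A B : Set} (f : A → B) (x : A) (xs : List A) → lastOf (f x) (map f xs) ≡ f (lastOf x xs)
lastOf-map f x []       = refl
lastOf-map f x (y ∷ ys) = lastOf-map f y ys

lastOf-cong : {A : Set} {x y : A} {xs ys : List A} → x ∷ xs ≡ y ∷ ys → lastOf x xs ≡ lastOf y ys
lastOf-cong refl = refl

record LatticeLift (ℓ : Point n k) (vs : List (Subset n)) : Set where
  field
    tail     : List (Point n k)
    Lpts≡    : Lpts ℓ vs ≡ ℓ ∷ tail
    distinct : All DistinctCoords (ℓ ∷ tail)
    linked   : Linked LatticeStep (ℓ ∷ tail)
    steps≡   : stepsWith lStep (ℓ ∷ tail) ≡ stepsWith vStep vs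
    supports : map support (ℓ ∷ tail) ≡ vs

support-vertices : {ls : List (Point n k)} → All DistinctCoords ls → All (IsVertex k) (map support ls)
support-vertices ds = map⁺ (All.map (λ {ℓ} → ∣support∣≡k ℓ) ds)

module _ {c : Fin n → ℚ} (c-increasing : StrictlyIncreasing c) where

  latticeLift : {ℓ : Point n k} {v : Subset n} (vs : List (Subset n)) → 1 ≤ k →
                DistinctCoords ℓ → support ℓ ≡ v →
                All (IsVertex k) (v ∷ vs) → Linked (MonotoneStep k c) (v ∷ vs) → LatticeLift ℓ (v ∷ vs)
  latticeLift []       _   dℓ refl _ _ = record
    { tail = [] ; Lpts≡ = refl ; distinct = dℓ ∷ [] ; linked = [-] ; steps≡ = refl ; supports = refl }
  latticeLift {ℓ = ℓ} (w ∷ vs) 1≤k dℓ refl (_ ∷ w-vertex ∷ vertices) (step ∷ steps)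
    with monotoneStep⇒latticeStep c-increasing ℓ w 1≤k dℓ w-vertex step
  ... | ℓ′≡w , dℓ′ , lstep , lStep≡ = record
    { tail     = _ ∷ tail
    ; Lpts≡    = cong (ℓ ∷_) Lpts≡
    ; distinct = dℓ ∷ distinct
    ; linked   = lstep ∷ linked
    ; steps≡   = cong₂ _∷_ lStep≡ steps≡
    ; supports = cong (support ℓ ∷_) supports
    }
    where
    open LatticeLift
      (latticeLift {ℓ = applyStep (vStep (support ℓ) w) ℓ} vs 1≤k dℓ′ ℓ′≡w (w-vertex ∷ vertices) steps)

  support-monotone : {ls : List (Point n k)} → All DistinctCoords ls → Linked LatticeStep ls →
                     Linked (MonotoneStep k c) (map support ls)
  support-monotone _                [] = []
  support-monotone _                [-] = [-]
  support-monotone {ls = ℓ ∷ ℓ′ ∷ _} (dℓ ∷ dℓ′ ∷ ds) (step ∷ steps) =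
    proj₁ (latticeStep⇒monotoneStep c-increasing ℓ ℓ′ dℓ dℓ′ step) ∷ support-monotone (dℓ′ ∷ ds) steps

  Lpts-support : (ℓ : Point n k) (ls : List (Point n k)) →
                 All DistinctCoords (ℓ ∷ ls) → Linked LatticeStep (ℓ ∷ ls) →
                 Lpts ℓ (map support (ℓ ∷ ls)) ≡ ℓ ∷ ls
  Lpts-support ℓ []        _                _              = refl
  Lpts-support ℓ (ℓ′ ∷ ls) (dℓ ∷ dℓ′ ∷ ds) (step ∷ steps) = cong (ℓ ∷_) (begin
    Lpts (applyStep (vStep (support ℓ) (support ℓ′)) ℓ) (map support (ℓ′ ∷ ls))
      ≡⟨ cong (λ m → Lpts m (map support (ℓ′ ∷ ls)))
              (proj₂ (latticeStep⇒monotoneStep c-increasing ℓ ℓ′ dℓ dℓ′ step)) ⟩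
    Lpts ℓ′ (map support (ℓ′ ∷ ls))
      ≡⟨ Lpts-support ℓ′ ls (dℓ′ ∷ ds) steps ⟩
    ℓ′ ∷ ls ∎)
    where open ≡-Reasoning

module _ {c : Fin n → ℚ} (c-increasing : StrictlyIncreasing c) (k≤n : k ≤ n) where

  private
    start : Point n k
    start = startPt n k k≤n

  𝓛-latticeLift : 1 ≤ k → (vs : List (Subset n)) → IsMonotonePath n k c vs → LatticeLift start vs
  𝓛-latticeLift 1≤k _ (_ , rest , refl , v₁≡top , _ , vertices , steps) =
    latticeLift c-increasing rest 1≤k (startPt-distinct k k≤n) (trans (support-startPt k k≤n) (sym v₁≡top))
                vertices steps

  𝓛-isDALP : 1 ≤ k → (vs : List (Subset n)) → IsMonotonePath n k c vs →
             IsDALP n k (𝓛 k≤n vs) × stepsWith lStep (𝓛 k≤n vs) ≡ stepsWith vStep vs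
  𝓛-isDALP 1≤k vs P@(_ , _ , refl , _ , last≡bottom , _ , _) =
    subst (λ ls → IsDALP n k ls × stepsWith lStep ls ≡ stepsWith vStep vs) (sym Lpts≡)
      ( ( start , tail , refl , startPt-isStartPoint k k≤n
        , support≡bottom⇒isEndPoint (lastOf start tail)
            (trans (sym (lastOf-map support start tail)) (trans (lastOf-cong supports) last≡bottom))
        , distinct , linked)
      , steps≡)
    where open LatticeLift (𝓛-latticeLift 1≤k vs P)

  support∘𝓛 : 1 ≤ k → (vs : List (Subset n)) → IsMonotonePath n k c vs → map support (𝓛 k≤n vs) ≡ vs
  support∘𝓛 1≤k vs P = trans (cong (map support) Lpts≡) supports
    where open LatticeLift (𝓛-latticeLift 1≤k vs P)

  𝓛-injective : 1 ≤ k → (vs ws : List (Subset n)) → IsMonotonePath n k c vs → IsMonotonePath n k c ws →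
                𝓛 k≤n vs ≡ 𝓛 k≤n ws → vs ≡ ws
  𝓛-injective 1≤k vs ws P Q 𝓛vs≡𝓛ws =
    trans (sym (support∘𝓛 1≤k vs P)) (trans (cong (map support) 𝓛vs≡𝓛ws) (support∘𝓛 1≤k ws Q))

  𝓛-surjective : (ls : List (Point n k)) → IsDALP n k ls →
                 Σ (List (Subset n)) (λ vs → IsMonotonePath n k c vs × 𝓛 k≤n vs ≡ ls)
  𝓛-surjective _ (ℓ₁ , ls , refl , ℓ₁-start , last-end , ds , steps)
    with refl ← isStartPoint⇒≡startPt k k≤n ℓ₁ ℓ₁-start =
      map support (start ∷ ls)
    , ( support start , map support ls , refl , support-startPt k k≤n
      , trans (lastOf-map support start ls) (isEndPoint⇒support≡bottom (lastOf start ls) last-end)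
      , support-vertices ds , support-monotone c-increasing ds steps)
    , Lpts-support c-increasing start ls ds steps

proposition4p2 : (n k : ℕ) → 2 ≤ n → 1 ≤ k → (k≤n : k ≤ n) →
    (c : Fin n → ℚ) → StrictlyIncreasing c →
    ((vs : List (Subset n)) → IsMonotonePath n k c vs →
        IsDALP n k (𝓛 k≤n vs) × (stepsWith lStep (𝓛 k≤n vs) ≡ stepsWith vStep vs))
    × ((vs ws : List (Subset n)) → IsMonotonePath n k c vs → IsMonotonePath n k c ws →
        𝓛 k≤n vs ≡ 𝓛 k≤n ws → vs ≡ ws)
    × ((ls : List (Point n k)) → IsDALP n k ls →
        Σ (List (Subset n)) (λ vs → IsMonotonePath n k c vs × (𝓛 k≤n vs ≡ ls)))
proposition4p2 n k _ 1≤k k≤n c c-increasing =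
  𝓛-isDALP c-increasing k≤n 1≤k , 𝓛-injective c-increasing k≤n 1≤k , 𝓛-surjective c-increasing k≤n
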